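{- Let $X$ be a $k$-dimensional simplicial complex, $A_{k-1}=A_{k-1}(X)$, and $h\geq 0$. Assume that for all $F\in X_{k-2}$ and all $w\in C^0(\mathrm{lk}\,F)$ with $w\perp\mathbf{1}$ we have $|\langle A(\mathrm{lk}\,F)w,w\rangle|\leq h\langle w,w\rangle$. Then for all $z$ in the orthogonal complement of $B^{k-1}(X)$ (with respect to the standard inner product), $|\langle A_{k-1}z,z\rangle|\leq k\,h\,\langle z,z\rangle$.
   Context: A simplicial complex $X$ is a finite family of sets closed under subsets; $X_i$ is the set of faces with $i+1$ elements; vertices are linearly ordered. For an $i$-face $F=\{v_0<\dots<v_i\}$ and $(i-1)$-face $G$, $[F:G]=(-1)^j$ if $G=F\setminus\{v_j\}$, and $0$ if $G\not\subseteq F$. $C^i(X;\mathbb{R})=\mathbb{R}^{X_i}$ with the standard inner product $\langle f,g\rangle=\sum_F f(F)g(F)$; the coboundary is $(\delta_i f)(H)=\sum_{G\in X_i}[H:G]f(G)$ and $B^{k-1}(X)=\mathrm{im}\,\delta_{k-2}$. $A_{k-1}(X)$ is the $X_{k-1}\times X_{k-1}$ matrix with entry $[F:F\cap G][G:F\cap G]$ if $F\ne G$, $|F\cap G|=k-1$ and $F\cup G\in X_k$, and $0$ otherwise. For $F\in X_{k-2}$, $\mathrm{lk}\,F$ is the graph with vertex set $\{v\notin F:F\cup\{v\}\in X\}$ and edges $\{u,v\}$ with $F\cup\{u,v\}\in X_k$; $C^0(\mathrm{lk}\,F)$ is the space of real functions on its vertex set with the standard inner product, $A(\mathrm{lk}\,F)$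 its $0/1$ adjacency matrix, and $\mathbf{1}$ the all-ones vector. -}

module Defs where

open import Data.Unit using (⊤)
open import Level using (Level; _⊔_; Lift) renaming (suc to lsuc)
open import Data.Nat as ℕ using (ℕ; zero; suc; _≡ᵇ_)
open import Data.Bool using (Bool; true; false; if_then_else_; _∧_; not)
open import Data.Fin using (Fin)
open import Data.Fin.Subset using (Subset; _⊆_; ∣_∣; _∩_; _∪_; ⁅_⁆)
open import Data.Vec using (Vec; []; _∷_)
import Data.Vec
open import Data.List using (List; []; _∷_; allFin)
open import Data.List.Membership.Propositional using () renaming (_∈_ to _∈ᴸ_)
open import Data.List.Relation.Unary.Unique.Propositional using (Unique)
open import Data.Maybe using (Maybe; just; nothing)
import Data.Maybe as Maybe
import Data.Fin
open import Data.Product using (_×_; ∃)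
open import Relation.Nullary using (¬_)
open import Relation.Binary using (Rel; IsTotalOrder)
open import Algebra.Bundles using (CommutativeRing)

record OrderedField (c ℓ₁ ℓ₂ : Level) : Set (lsuc (c ⊔ ℓ₁ ⊔ ℓ₂)) where
  field
    commutativeRing : CommutativeRing c ℓ₁
  open CommutativeRing commutativeRing public
  field
    _≤_          : Rel Carrier ℓ₂
    isTotalOrder : IsTotalOrder _≈_ _≤_
    +-monoʳ-≤    : ∀ {x y} z → x ≤ y → (x + z) ≤ (y + z)
    *-nonneg     : ∀ {x y} → 0# ≤ x → 0# ≤ y → 0# ≤ (x * y)
    0≉1          : ¬ (0# ≈ 1#)
    inverse      : ∀ x → ¬ (x ≈ 0#) → ∃ λ y → (x * y) ≈ 1#

eqᵇ : ∀ {n} → Subset n → Subset n → Bool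
eqᵇ []          []          = true
eqᵇ (true ∷ F)  (true ∷ G)  = eqᵇ F G
eqᵇ (false ∷ F) (false ∷ G) = eqᵇ F G
eqᵇ (true ∷ F)  (false ∷ G) = false
eqᵇ (false ∷ F) (true ∷ G)  = false

memᵇ : ∀ {n} → Subset n → List (Subset n) → Bool
memᵇ F []       = false
memᵇ F (G ∷ Gs) = if eqᵇ F G then true else memᵇ F Gs

eqFinᵇ : ∀ {n} → Fin n → Fin n → Bool
eqFinᵇ u v = Data.Fin.toℕ u ≡ᵇ Data.Fin.toℕ v

-- position F G = just j  iff  G = F \ {v_j} where F = {v_0 < ... < v_i};
-- nothing otherwise.
position : ∀ {n} → Subset n → Subset n → Maybe ℕ
position []          []          = nothing
position (true ∷ F)  (true ∷ G)  = Maybe.map suc (position F G)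
position (true ∷ F)  (false ∷ G) = if eqᵇ F G then just 0 else nothing
position (false ∷ F) (false ∷ G) = position F G
position (false ∷ F) (true ∷ G)  = nothing

record SimplicialComplex (n : ℕ) : Set where
  field
    faces  : List (Subset n)
    unique : Unique faces
    closed : ∀ {F G} → F ∈ᴸ faces → G ⊆ F → G ∈ᴸ faces
open SimplicialComplex public

IsDimension : ∀ {n} → SimplicialComplex n → ℕ → Set
IsDimension X k =
  (∀ {F} → F ∈ᴸ faces X → ∣ F ∣ ℕ.≤ suc k) × ∃ λ F → F ∈ᴸ faces X × ∣ F ∣ ≡ suc k
  where open import Relation.Binary.PropositionalEquality using (_≡_)

module _ {c ℓ₁ ℓ₂} (𝔽 : OrderedField c ℓ₁ ℓ₂) where
  open OrderedField 𝔽

  sumL : ∀ {a} {A : Set a} → List A → (A → Carrier) → Carrier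
  sumL []       f = 0#
  sumL (x ∷ xs) f = f x + sumL xs f

  sumWhere : ∀ {a} {A : Set a} → List A → (A → Bool) → (A → Carrier) → Carrier
  sumWhere xs p f = sumL xs (λ x → if p x then f x else 0#)

  fromℕ : ℕ → Carrier
  fromℕ zero    = 0#
  fromℕ (suc m) = 1# + fromℕ m

  sgn : ℕ → Carrier
  sgn zero    = 1#
  sgn (suc j) = - sgn j

  AbsLe : Carrier → Carrier → Set ℓ₂
  AbsLe x y = ((- y) ≤ x) × (x ≤ y)

  incidence : ∀ {n} → Subset n → Subset n → Carrier
  incidence F G with position F G
  ... | just j  = sgn j
  ... | nothing = 0#

  module _ {n : ℕ} (X : SimplicialComplex n) where

    -- Cochains: C^i(X) is represented by functions Subset n → Carrier,
    -- of which only the values on X_i (faces of size i+1) are used.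
    Cochain : Set c
    Cochain = Subset n → Carrier

    sumSize : ℕ → (Subset n → Carrier) → Carrier
    sumSize m = sumWhere (faces X) (λ F → ∣ F ∣ ≡ᵇ m)

    inner : ℕ → Cochain → Cochain → Carrier
    inner m f g = sumSize m (λ F → f F * g F)

    δ : ℕ → Cochain → Cochain
    δ m f H = sumSize m (λ G → incidence H G * f G)

    -- the matrix A_{k-1}(X), indexed by faces of size k
    Aentry : ℕ → Subset n → Subset n → Carrier
    Aentry k F G =
      if not (eqᵇ F G) ∧ (suc ∣ F ∩ G ∣ ≡ᵇ k) ∧ memᵇ (F ∪ G) (faces X)
      then incidence F (F ∩ G) * incidence G (F ∩ G)
      else 0#

    quadA : ℕ → Cochain → Carrier
    quadA k z = sumSize k (λ F → sumSize k (λ G → Aentry k F G * z G) * z F)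

    inLink : Subset n → Fin n → Bool
    inLink F v = not (Data.Vec.lookup F v) ∧ memᵇ (F ∪ ⁅ v ⁆) (faces X)

    linkAdj : Subset n → Fin n → Fin n → Carrier
    linkAdj F u v =
      if not (eqFinᵇ u v) ∧ memᵇ (F ∪ (⁅ u ⁆ ∪ ⁅ v ⁆)) (faces X) then 1# else 0#

    sumLink : Subset n → (Fin n → Carrier) → Carrier
    sumLink F = sumWhere (allFin n) (inLink F)

    innerOne : Subset n → (Fin n → Carrier) → Carrier
    innerOne F w = sumLink F w

    innerLink : Subset n → (Fin n → Carrier) → Carrier
    innerLink F w = sumLink F (λ u → w u * w u)

    quadLink : Subset n → (Fin n → Carrier) → Carrier
    quadLink F w = sumLink F (λ u → sumLink F (λ v → linkAdj F u v * w v) * w u)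

    -- z ∈ (B^{k-1}(X))^⊥ where B^{k-1} = im δ_{k-2}, δ_{k-2} : C^{k-2} → C^{k-1}.
    -- Faces of X_{k-1} have k elements; for k = 0, C^{-2} = 0 so B^{-1} = 0.
    PerpCoboundaries : ℕ → Cochain → Set (c ⊔ ℓ₁)
    PerpCoboundaries zero    z = Lift (c ⊔ ℓ₁) ⊤
    PerpCoboundaries (suc m) z = ∀ (f : Cochain) → inner (suc m) (δ m f) z ≈ 0#

-- For F ∈ X_{k-2} restrict z to the link of F by z_F(v) = [F ∪ {v} : F] z(F ∪ {v}).  Summing over
-- F ∈ X_{k-2}, each (k-1)-face is reached from each of its k facets, so Σ_F ⟨z_F, z_F⟩ = k ⟨z, z⟩, and each
-- pair of adjacent (k-1)-faces G ≠ G′ is reached only from F = G ∩ G′, with sign [G : F] [G′ : F], so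
-- Σ_F ⟨A(lk F) z_F, z_F⟩ = ⟨A_{k-1} z, z⟩.  Finally ⟨z_F, 𝟏⟩ = ⟨δ 1_F, z⟩ = 0 for z ⊥ B^{k-1}, so the
-- hypothesis bounds every summand, and the bounds add up to the claim.
-- To exchange the order of summation, every sum over X_m is written as a sum over all subsets of the
-- vertex set, masked by onFaces m.

module Submission where

open import Defs
open import Level using (Level; _⊔_)
open import Data.Nat using (ℕ; zero; suc; _≡ᵇ_)
open import Data.Nat.Properties using (≡ᵇ⇒≡; ≡⇒≡ᵇ)
open import Data.Bool using (Bool; true; false; if_then_else_; _∧_; _∨_; not)
open import Data.Bool.Properties using (T-≡)
open import Data.Empty using (⊥-elim)
open import Data.Fin using (Fin; zero; suc)
open import Data.Fin.Subset using (Subset; _⊆_; _∪_; _∩_; ⁅_⁆; ∣_∣)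
import Data.Fin.Subset as Subset
open import Data.Fin.Subset.Properties
  using (⊆-refl; ⊆-antisym; ∩-comm; s⊆s; out⊆; p⊆p∪q; q⊆p∪q; p∩q⊆p; x∈p∩q⁺; ∪-identityʳ)
open import Data.List using (List; []; _∷_; _++_; map; allFin)
import Data.List.Properties as List
open import Data.List.Membership.Propositional using (_∈_)
open import Data.List.Relation.Unary.Any using (here; there)
import Data.List.Relation.Unary.All as All
open import Data.List.Relation.Unary.AllPairs using (_∷_)
open import Data.List.Relation.Unary.Unique.Propositional using (Unique)
open import Data.Maybe using (just; nothing)
open import Data.Product using (_×_; _,_)
open import Data.Sum using (_⊎_; inj₁; inj₂)
open import Data.Vec using ([]; _∷_; lookup)
open import Function using (id; Equivalence)
open import Relation.Binary using (IsTotalOrder)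
open import Relation.Binary.PropositionalEquality as ≡ using (_≡_)

≡ᵇ-refl : ∀ m → (m ≡ᵇ m) ≡ true
≡ᵇ-refl m = Equivalence.to T-≡ (≡⇒≡ᵇ m m ≡.refl)

≡ᵇ-sound : ∀ m n → (m ≡ᵇ n) ≡ true → m ≡ n
≡ᵇ-sound m n e = ≡ᵇ⇒≡ m n (Equivalence.from T-≡ e)

eqᵇ-refl : ∀ {n} (F : Subset n) → eqᵇ F F ≡ true
eqᵇ-refl []          = ≡.refl
eqᵇ-refl (true ∷ F)  = eqᵇ-refl F
eqᵇ-refl (false ∷ F) = eqᵇ-refl F

eqᵇ-sound : ∀ {n} (F G : Subset n) → eqᵇ F G ≡ true → F ≡ G
eqᵇ-sound []          []          e = ≡.refl
eqᵇ-sound (true ∷ F)  (true ∷ G)  e = ≡.cong (true ∷_) (eqᵇ-sound F G e)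
eqᵇ-sound (false ∷ F) (false ∷ G) e = ≡.cong (false ∷_) (eqᵇ-sound F G e)

eqᵇ-sym : ∀ {n} (F G : Subset n) → eqᵇ F G ≡ eqᵇ G F
eqᵇ-sym []          []          = ≡.refl
eqᵇ-sym (true ∷ F)  (true ∷ G)  = eqᵇ-sym F G
eqᵇ-sym (false ∷ F) (false ∷ G) = eqᵇ-sym F G
eqᵇ-sym (true ∷ F)  (false ∷ G) = ≡.refl
eqᵇ-sym (false ∷ F) (true ∷ G)  = ≡.refl

memᵇ-sound : ∀ {n} (F : Subset n) Fs → memᵇ F Fs ≡ true → F ∈ Fs
memᵇ-sound F (G ∷ Fs) e with eqᵇ F G in eq
... | true  = here (eqᵇ-sound F G eq)
... | false = there (memᵇ-sound F Fs e)

memᵇ-complete : ∀ {n} (F : Subset n) Fs → F ∈ Fs → memᵇ F Fs ≡ true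
memᵇ-complete F (G ∷ Fs) (here ≡.refl) rewrite eqᵇ-refl F = ≡.refl
memᵇ-complete F (G ∷ Fs) (there F∈Fs) with eqᵇ F G
... | true  = ≡.refl
... | false = memᵇ-complete F Fs F∈Fs

⊆⇒∩≡ˡ : ∀ {n} {F G : Subset n} → F ⊆ G → F ∩ G ≡ F
⊆⇒∩≡ˡ {F = F} {G} F⊆G = ⊆-antisym (p∩q⊆p F G) (λ x∈F → x∈p∩q⁺ (x∈F , F⊆G x∈F))

eqᵇ-∪⁅⁆ : ∀ {n} (F : Subset n) u v → lookup F u ≡ false → lookup F v ≡ false →
          eqᵇ (F ∪ ⁅ u ⁆) (F ∪ ⁅ v ⁆) ≡ eqFinᵇ u v
eqᵇ-∪⁅⁆ (false ∷ F) zero    zero    _  _  = eqᵇ-refl (F ∪ Subset.⊥)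
eqᵇ-∪⁅⁆ (false ∷ F) zero    (suc v) _  _  = ≡.refl
eqᵇ-∪⁅⁆ (false ∷ F) (suc u) zero    _  _  = ≡.refl
eqᵇ-∪⁅⁆ (true ∷ F)  (suc u) (suc v) eu ev = eqᵇ-∪⁅⁆ F u v eu ev
eqᵇ-∪⁅⁆ (false ∷ F) (suc u) (suc v) eu ev = eqᵇ-∪⁅⁆ F u v eu ev

∪-distribˡ-∪ : ∀ {n} (F G H : Subset n) → (F ∪ G) ∪ (F ∪ H) ≡ F ∪ (G ∪ H)
∪-distribˡ-∪ []          []      []      = ≡.refl
∪-distribˡ-∪ (true ∷ F)  (_ ∷ G) (_ ∷ H) = ≡.cong (true ∷_) (∪-distribˡ-∪ F G H)
∪-distribˡ-∪ (false ∷ F) (b ∷ G) (c ∷ H) = ≡.cong ((b ∨ c) ∷_) (∪-distribˡ-∪ F G H)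

allSubsets : ∀ n → List (Subset n)
allSubsets zero    = [] ∷ []
allSubsets (suc n) = map (false ∷_) (allSubsets n) ++ map (true ∷_) (allSubsets n)

position-just : ∀ {n} (H F : Subset n) {j} → position H F ≡ just j → F ⊆ H × suc ∣ F ∣ ≡ ∣ H ∣
position-just [] [] ()
position-just (true ∷ H)  (true ∷ F)  e with position H F in e′
... | just _ = let F⊆H , 1+∣F∣≡∣H∣ = position-just H F e′ in s⊆s F⊆H , ≡.cong suc 1+∣F∣≡∣H∣
position-just (true ∷ H)  (false ∷ F) e with eqᵇ H F in e′
... | true rewrite eqᵇ-sound H F e′ = out⊆ ⊆-refl , ≡.refl
position-just (false ∷ H) (false ∷ F) e = let F⊆H , 1+∣F∣≡∣H∣ = position-just H F e in s⊆s F⊆H , 1+∣F∣≡∣H∣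

module _ {c ℓ₁ ℓ₂} (𝔽 : OrderedField c ℓ₁ ℓ₂) where
  open OrderedField 𝔽 hiding (zero)
  open import Algebra.Properties.Ring ring using (-‿distribˡ-*; -‿distribʳ-*; -‿+-comm; -‿involutive; -0#≈0#)
  open import Relation.Binary.Reasoning.Setoid setoid
  open import Algebra.Solver.CommutativeMonoid *-commutativeMonoid as ×-Solver using (_⊜_; _⊕_)

  ∑ : ∀ {a} {A : Set a} → List A → (A → Carrier) → Carrier
  ∑ = sumL 𝔽

  -x*-y≈x*y : ∀ x y → - x * - y ≈ x * y
  -x*-y≈x*y x y = begin
    - x * - y   ≈⟨ -‿distribˡ-* x (- y) ⟨
    - (x * - y) ≈⟨ -‿cong (-‿distribʳ-* x y) ⟨
    - - (x * y) ≈⟨ -‿involutive (x * y) ⟩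
    x * y       ∎

  when : Bool → Carrier → Carrier
  when b x = if b then x else 0#

  when-cong : ∀ b {x y} → x ≈ y → when b x ≈ when b y
  when-cong true  x≈y = x≈y
  when-cong false _   = refl

  when-zero : ∀ b {x} → x ≈ 0# → when b x ≈ 0#
  when-zero true  x≈0 = x≈0
  when-zero false _   = refl

  when-*ˡ : ∀ b x y → when b x * y ≈ when b (x * y)
  when-*ˡ true  x y = refl
  when-*ˡ false x y = zeroˡ y

  when-*ʳ : ∀ b x y → x * when b y ≈ when b (x * y)
  when-*ʳ true  x y = refl
  when-*ʳ false x y = zeroʳ x

  when-neg : ∀ b x → - when b x ≈ when b (- x)
  when-neg true  x = refl
  when-neg false x = -0#≈0#

  when-∧ : ∀ a b x → when (a ∧ b) x ≡ when a (when b x)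
  when-∧ true  b x = ≡.refl
  when-∧ false b x = ≡.refl

  when-absorb : ∀ a b x → (b ≡ true → a ≡ true) → when a (when b x) ≈ when b x
  when-absorb a     false x _   = when-zero a refl
  when-absorb a     true  x b⇒a rewrite b⇒a ≡.refl = refl

  private variable
    a b : Level
    A : Set a
    B : Set b

  ∑-cong : ∀ xs {f g : A → Carrier} → (∀ x → f x ≈ g x) → ∑ xs f ≈ ∑ xs g
  ∑-cong []       f≈g = refl
  ∑-cong (x ∷ xs) f≈g = +-cong (f≈g x) (∑-cong xs f≈g)

  ∑-zero : ∀ xs {f : A → Carrier} → (∀ x → f x ≈ 0#) → ∑ xs f ≈ 0#
  ∑-zero []       f≈0 = refl
  ∑-zero (x ∷ xs) f≈0 = trans (+-cong (f≈0 x) (∑-zero xs f≈0)) (+-identityˡ 0#)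

  ∑-+ : ∀ xs (f g : A → Carrier) → ∑ xs (λ x → f x + g x) ≈ ∑ xs f + ∑ xs g
  ∑-+ []       f g = sym (+-identityˡ 0#)
  ∑-+ (x ∷ xs) f g = begin
    (f x + g x) + ∑ xs (λ x → f x + g x) ≈⟨ +-congˡ (∑-+ xs f g) ⟩
    (f x + g x) + (∑ xs f + ∑ xs g)      ≈⟨ +-assoc (f x) (g x) _ ⟩
    f x + (g x + (∑ xs f + ∑ xs g))      ≈⟨ +-congˡ (+-assoc (g x) (∑ xs f) (∑ xs g)) ⟨
    f x + ((g x + ∑ xs f) + ∑ xs g)      ≈⟨ +-congˡ (+-congʳ (+-comm (g x) (∑ xs f))) ⟩
    f x + ((∑ xs f + g x) + ∑ xs g)      ≈⟨ +-congˡ (+-assoc (∑ xs f) (g x) (∑ xs g)) ⟩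
    f x + (∑ xs f + (g x + ∑ xs g))      ≈⟨ +-assoc (f x) (∑ xs f) _ ⟨
    (f x + ∑ xs f) + (g x + ∑ xs g)      ∎

  ∑-*ˡ : ∀ xs k (f : A → Carrier) → ∑ xs (λ x → k * f x) ≈ k * ∑ xs f
  ∑-*ˡ []       k f = sym (zeroʳ k)
  ∑-*ˡ (x ∷ xs) k f = trans (+-congˡ (∑-*ˡ xs k f)) (sym (distribˡ k (f x) (∑ xs f)))

  ∑-*ʳ : ∀ xs k (f : A → Carrier) → ∑ xs (λ x → f x * k) ≈ ∑ xs f * k
  ∑-*ʳ xs k f = trans (∑-cong xs (λ x → *-comm (f x) k)) (trans (∑-*ˡ xs k f) (*-comm k (∑ xs f)))

  ∑-neg : ∀ xs (f : A → Carrier) → ∑ xs (λ x → - f x) ≈ - ∑ xs f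
  ∑-neg []       f = sym -0#≈0#
  ∑-neg (x ∷ xs) f = trans (+-congˡ (∑-neg xs f)) (-‿+-comm (f x) (∑ xs f))

  ∑-when : ∀ xs b (f : A → Carrier) → ∑ xs (λ x → when b (f x)) ≈ when b (∑ xs f)
  ∑-when xs true  f = refl
  ∑-when xs false f = ∑-zero xs (λ _ → refl)

  ∑-++ : ∀ xs ys (f : A → Carrier) → ∑ (xs ++ ys) f ≈ ∑ xs f + ∑ ys f
  ∑-++ []       ys f = sym (+-identityˡ _)
  ∑-++ (x ∷ xs) ys f = trans (+-congˡ (∑-++ xs ys f)) (sym (+-assoc _ _ _))

  ∑-map : ∀ (g : B → A) xs (f : A → Carrier) → ∑ (map g xs) f ≡ ∑ xs (λ x → f (g x))
  ∑-map g []       f = ≡.refl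
  ∑-map g (x ∷ xs) f = ≡.cong (f (g x) +_) (∑-map g xs f)

  ∑-comm : ∀ xs (ys : List B) (f : A → B → Carrier) →
           ∑ xs (λ x → ∑ ys (f x)) ≈ ∑ ys (λ y → ∑ xs (λ x → f x y))
  ∑-comm []       ys f = sym (∑-zero ys (λ _ → refl))
  ∑-comm (x ∷ xs) ys f = begin
    ∑ ys (f x) + ∑ xs (λ x → ∑ ys (f x))          ≈⟨ +-congˡ (∑-comm xs ys f) ⟩
    ∑ ys (f x) + ∑ ys (λ y → ∑ xs (λ x → f x y))  ≈⟨ ∑-+ ys (f x) _ ⟨
    ∑ ys (λ y → f x y + ∑ xs (λ x → f x y))       ∎

  ∑-allSubsets-suc : ∀ n (f : Subset (suc n) → Carrier) →
    ∑ (allSubsets (suc n)) f ≈ ∑ (allSubsets n) (λ F → f (false ∷ F)) + ∑ (allSubsets n) (λ F → f (true ∷ F))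
  ∑-allSubsets-suc n f = trans (∑-++ (map (false ∷_) (allSubsets n)) _ f)
    (+-cong (reflexive (∑-map _ (allSubsets n) f)) (reflexive (∑-map _ (allSubsets n) f)))

  ∑-allFin-suc : ∀ n (g : Fin (suc n) → Carrier) → ∑ (allFin (suc n)) g ≡ g zero + ∑ (allFin n) (λ v → g (suc v))
  ∑-allFin-suc n g = ≡.cong (g zero +_)
    (≡.trans (≡.cong (λ vs → ∑ vs g) (≡.sym (List.map-tabulate id suc))) (∑-map suc (allFin n) g))

  ∑-select : ∀ n (G : Subset n) (f : Subset n → Carrier) → ∑ (allSubsets n) (λ H → when (eqᵇ H G) (f H)) ≈ f G
  ∑-select zero    []          f = +-identityʳ (f [])
  ∑-select (suc n) (false ∷ G) f = trans (∑-allSubsets-suc n _) (trans (+-congˡ (∑-zero (allSubsets n) (λ _ → refl)))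
    (trans (+-identityʳ _) (∑-select n G (λ H → f (false ∷ H)))))
  ∑-select (suc n) (true ∷ G)  f = trans (∑-allSubsets-suc n _) (trans (+-congʳ (∑-zero (allSubsets n) (λ _ → refl)))
    (trans (+-identityˡ _) (∑-select n G (λ H → f (true ∷ H)))))

  ∑-select′ : ∀ n (G : Subset n) (f : Subset n → Carrier) → ∑ (allSubsets n) (λ H → when (eqᵇ G H) (f H)) ≈ f G
  ∑-select′ n G f = trans (∑-cong (allSubsets n) (λ H → reflexive (≡.cong (λ b → when b (f H)) (eqᵇ-sym G H))))
                         (∑-select n G f)

  ∑-unique : ∀ {n} (Fs : List (Subset n)) → Unique Fs → (g : Subset n → Carrier) →
             ∑ Fs g ≈ ∑ (allSubsets n) (λ F → when (memᵇ F Fs) (g F))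
  ∑-unique {n} []       _            g = sym (∑-zero (allSubsets n) (λ _ → refl))
  ∑-unique {n} (G ∷ Fs) (G∉Fs ∷ uFs) g = begin
    g G + ∑ Fs g                                                   ≈⟨ +-cong (sym (∑-select n G g)) (∑-unique Fs uFs g) ⟩
    ∑ all (λ F → when (eqᵇ F G) (g F)) + ∑ all (λ F → when (memᵇ F Fs) (g F)) ≈⟨ ∑-+ all _ _ ⟨
    ∑ all (λ F → when (eqᵇ F G) (g F) + when (memᵇ F Fs) (g F))    ≈⟨ ∑-cong all disjoint ⟩
    ∑ all (λ F → when (memᵇ F (G ∷ Fs)) (g F))                      ∎
    where
    all = allSubsets n
    disjoint : ∀ F → when (eqᵇ F G) (g F) + when (memᵇ F Fs) (g F) ≈ when (memᵇ F (G ∷ Fs)) (g F)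
    disjoint F with eqᵇ F G in F≡G
    ... | false = +-identityˡ _
    ... | true with memᵇ F Fs in F∈Fs
    ...   | false = +-identityʳ _
    ...   | true  = ⊥-elim (All.lookup G∉Fs (memᵇ-sound F Fs F∈Fs) (≡.sym (eqᵇ-sound F G F≡G)))

  [_∶_] : ∀ {n} → Subset n → Subset n → Carrier
  [ H ∶ F ] = incidence 𝔽 H F

  incidence-false-false : ∀ {n} (H F : Subset n) → [ false ∷ H ∶ false ∷ F ] ≡ [ H ∶ F ]
  incidence-false-false H F with position H F
  ... | just _  = ≡.refl
  ... | nothing = ≡.refl

  incidence-true-false : ∀ {n} (H F : Subset n) → [ true ∷ H ∶ false ∷ F ] ≡ when (eqᵇ H F) 1#
  incidence-true-false H F with eqᵇ H F
  ... | true  = ≡.refl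
  ... | false = ≡.refl

  incidence-true-true : ∀ {n} (H F : Subset n) → [ true ∷ H ∶ true ∷ F ] ≈ - [ H ∶ F ]
  incidence-true-true H F with position H F
  ... | just _  = refl
  ... | nothing = sym -0#≈0#

  incidence-support : ∀ {n} (H F : Subset n) → [ H ∶ F ] ≈ 0# ⊎ (F ⊆ H × suc ∣ F ∣ ≡ ∣ H ∣)
  incidence-support H F with position H F in e
  ... | just _  = inj₂ (position-just H F e)
  ... | nothing = inj₁ refl

  incidence-when : ∀ {n} (H F : Subset n) x → [ true ∷ H ∶ false ∷ F ] * x ≈ when (eqᵇ H F) x
  incidence-when H F x rewrite incidence-true-false H F = trans (when-*ˡ (eqᵇ H F) 1# x) (when-cong (eqᵇ H F) (*-identityˡ x))

  -- Every coface of F is F ∪ ⁅ v ⁆ for a unique v ∉ F.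
  ∑-cofaces : ∀ n (F : Subset n) (Φ : Subset n → Carrier) →
    ∑ (allSubsets n) (λ H → [ H ∶ F ] * Φ H) ≈
    ∑ (allFin n) (λ v → when (not (lookup F v)) ([ F ∪ ⁅ v ⁆ ∶ F ] * Φ (F ∪ ⁅ v ⁆)))
  ∑-cofaces zero    []          Φ = trans (+-identityʳ _) (zeroˡ (Φ []))
  ∑-cofaces (suc n) (false ∷ F) Φ = begin
    ∑ (allSubsets (suc n)) (λ H → [ H ∶ false ∷ F ] * Φ H)
      ≈⟨ ∑-allSubsets-suc n _ ⟩
    ∑ (allSubsets n) (λ H → [ false ∷ H ∶ false ∷ F ] * Φ (false ∷ H)) +
    ∑ (allSubsets n) (λ H → [ true ∷ H ∶ false ∷ F ] * Φ (true ∷ H))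
      ≈⟨ +-cong (trans (∑-cong (allSubsets n) (λ H → reflexive (≡.cong (_* Φ (false ∷ H)) (incidence-false-false H F))))
                       (∑-cofaces n F (λ H → Φ (false ∷ H))))
                (trans (∑-cong (allSubsets n) (λ H → incidence-when H F _)) (∑-select n F (λ H → Φ (true ∷ H)))) ⟩
    R + Φ (true ∷ F)
      ≈⟨ +-comm R _ ⟩
    Φ (true ∷ F) + R
      ≈⟨ +-congʳ (sym (trans (incidence-when F F _) (reflexive (≡.cong (λ b → when b (Φ (true ∷ F))) (eqᵇ-refl F))))) ⟩
    [ true ∷ F ∶ false ∷ F ] * Φ (true ∷ F) + R
      ≡⟨ ≡.cong (λ G → [ true ∷ G ∶ false ∷ F ] * Φ (true ∷ G) + R) (≡.sym (∪-identityʳ F)) ⟩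
    [ true ∷ (F ∪ Subset.⊥) ∶ false ∷ F ] * Φ (true ∷ (F ∪ Subset.⊥)) + R
      ≡⟨ ≡.sym (∑-allFin-suc n _) ⟩
    ∑ (allFin (suc n)) (λ v → when (not (lookup (false ∷ F) v))
                                  ([ (false ∷ F) ∪ ⁅ v ⁆ ∶ false ∷ F ] * Φ ((false ∷ F) ∪ ⁅ v ⁆))) ∎
    where
    R = ∑ (allFin n) (λ v → when (not (lookup F v)) ([ F ∪ ⁅ v ⁆ ∶ F ] * Φ (false ∷ (F ∪ ⁅ v ⁆))))
  ∑-cofaces (suc n) (true ∷ F)  Φ = begin
    ∑ (allSubsets (suc n)) (λ H → [ H ∶ true ∷ F ] * Φ H)
      ≈⟨ ∑-allSubsets-suc n _ ⟩
    ∑ (allSubsets n) (λ H → [ false ∷ H ∶ true ∷ F ] * Φ (false ∷ H)) +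
    ∑ (allSubsets n) (λ H → [ true ∷ H ∶ true ∷ F ] * Φ (true ∷ H))
      ≈⟨ +-cong (∑-zero (allSubsets n) (λ _ → zeroˡ _))
                (∑-cong (allSubsets n) (λ H → trans (*-congʳ (incidence-true-true H F)) (sym (-‿distribˡ-* _ _)))) ⟩
    0# + ∑ (allSubsets n) (λ H → - ([ H ∶ F ] * Φ (true ∷ H)))
      ≈⟨ +-congˡ (∑-neg (allSubsets n) _) ⟩
    0# + - ∑ (allSubsets n) (λ H → [ H ∶ F ] * Φ (true ∷ H))
      ≈⟨ +-congˡ (-‿cong (∑-cofaces n F (λ H → Φ (true ∷ H)))) ⟩
    0# + - ∑ (allFin n) (λ v → when (not (lookup F v)) ([ F ∪ ⁅ v ⁆ ∶ F ] * Φ (true ∷ (F ∪ ⁅ v ⁆))))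
      ≈⟨ +-congˡ (∑-neg (allFin n) _) ⟨
    0# + ∑ (allFin n) (λ v → - when (not (lookup F v)) ([ F ∪ ⁅ v ⁆ ∶ F ] * Φ (true ∷ (F ∪ ⁅ v ⁆))))
      ≈⟨ +-congˡ (∑-cong (allFin n) (λ v → trans (when-neg (not (lookup F v)) _) (when-cong (not (lookup F v))
           (trans (-‿distribˡ-* _ _) (*-congʳ (sym (incidence-true-true (F ∪ ⁅ v ⁆) F))))))) ⟩
    0# + ∑ (allFin n) (λ v → when (not (lookup F v)) ([ true ∷ (F ∪ ⁅ v ⁆) ∶ true ∷ F ] * Φ (true ∷ (F ∪ ⁅ v ⁆))))
      ≡⟨ ≡.sym (∑-allFin-suc n _) ⟩
    ∑ (allFin (suc n)) (λ v → when (not (lookup (true ∷ F) v))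
                                  ([ (true ∷ F) ∪ ⁅ v ⁆ ∶ true ∷ F ] * Φ ((true ∷ F) ∪ ⁅ v ⁆))) ∎

  ∑-incidence² : ∀ n (G : Subset n) → ∑ (allSubsets n) (λ F → [ G ∶ F ] * [ G ∶ F ]) ≈ fromℕ 𝔽 ∣ G ∣
  ∑-incidence² zero    []          = trans (+-identityʳ _) (zeroˡ 0#)
  ∑-incidence² (suc n) (false ∷ G) = begin
    _             ≈⟨ ∑-allSubsets-suc n _ ⟩
    _ + _         ≈⟨ +-cong (∑-cong (allSubsets n) (λ F → reflexive (≡.cong (λ x → x * x) (incidence-false-false G F))))
                            (∑-zero (allSubsets n) (λ F → zeroˡ 0#)) ⟩
    _ + 0#        ≈⟨ +-identityʳ _ ⟩
    _             ≈⟨ ∑-incidence² n G ⟩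
    fromℕ 𝔽 ∣ G ∣ ∎
  ∑-incidence² (suc n) (true ∷ G)  = begin
    _ ≈⟨ ∑-allSubsets-suc n _ ⟩
    _ + _
      ≈⟨ +-cong (trans (∑-cong (allSubsets n) (λ F → incidence-when G F _)) (∑-select′ n G _))
                (∑-cong (allSubsets n) (λ F → trans (*-cong (incidence-true-true G F) (incidence-true-true G F))
                                                    (-x*-y≈x*y _ _))) ⟩
    [ true ∷ G ∶ false ∷ G ] + ∑ (allSubsets n) (λ F → [ G ∶ F ] * [ G ∶ F ])
      ≈⟨ +-cong (reflexive (≡.trans (incidence-true-false G G) (≡.cong (λ b → when b 1#) (eqᵇ-refl G))))
                (∑-incidence² n G) ⟩
    1# + fromℕ 𝔽 ∣ G ∣ ∎

  incidence-∩ : ∀ {n} (G G′ : Subset n) → [ G′ ∶ G ] ≈ when (eqᵇ G (G ∩ G′)) 1# * [ G′ ∶ G ∩ G′ ]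
  incidence-∩ G G′ with eqᵇ G (G ∩ G′) in e
  ... | true  = sym (trans (*-identityˡ _) (reflexive (≡.cong [ G′ ∶_] (≡.sym (eqᵇ-sound _ _ e)))))
  ... | false with incidence-support G′ G
  ...   | inj₁ [G′∶G]≈0   = trans [G′∶G]≈0 (sym (zeroˡ _))
  ...   | inj₂ (G⊆G′ , _)
    with () ← ≡.trans (≡.sym (eqᵇ-refl G)) (≡.trans (≡.cong (eqᵇ G) (≡.sym (⊆⇒∩≡ˡ G⊆G′))) e)

  ∑-incidence-product : ∀ n (G G′ : Subset n) → eqᵇ G G′ ≡ false →
    ∑ (allSubsets n) (λ F → [ G ∶ F ] * [ G′ ∶ F ]) ≈ [ G ∶ G ∩ G′ ] * [ G′ ∶ G ∩ G′ ]
  ∑-incidence-product zero    []          []           ()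
  ∑-incidence-product (suc n) (false ∷ G) (false ∷ G′) G≢G′ = begin
    _ ≈⟨ ∑-allSubsets-suc n _ ⟩
    _ + _
      ≈⟨ +-cong (∑-cong (allSubsets n) (λ F → reflexive (≡.cong₂ _*_ (incidence-false-false G F) (incidence-false-false G′ F))))
                (∑-zero (allSubsets n) (λ F → zeroˡ _)) ⟩
    ∑ (allSubsets n) (λ F → [ G ∶ F ] * [ G′ ∶ F ]) + 0#
      ≈⟨ +-identityʳ _ ⟩
    _ ≈⟨ ∑-incidence-product n G G′ G≢G′ ⟩
    [ G ∶ G ∩ G′ ] * [ G′ ∶ G ∩ G′ ]
      ≡⟨ ≡.sym (≡.cong₂ _*_ (incidence-false-false G (G ∩ G′)) (incidence-false-false G′ (G ∩ G′))) ⟩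
    [ false ∷ G ∶ false ∷ (G ∩ G′) ] * [ false ∷ G′ ∶ false ∷ (G ∩ G′) ] ∎
  ∑-incidence-product (suc n) (true ∷ G) (true ∷ G′) G≢G′ = begin
    _ ≈⟨ ∑-allSubsets-suc n _ ⟩
    _ + _
      ≈⟨ +-cong (trans (∑-cong (allSubsets n) (λ F → trans (incidence-when G F _)
                          (reflexive (≡.cong (when (eqᵇ G F)) (incidence-true-false G′ F)))))
                       (∑-select′ n G _))
                (∑-cong (allSubsets n) (λ F → trans (*-cong (incidence-true-true G F) (incidence-true-true G′ F)) (-x*-y≈x*y _ _))) ⟩
    when (eqᵇ G′ G) 1# + ∑ (allSubsets n) (λ F → [ G ∶ F ] * [ G′ ∶ F ])
      ≈⟨ +-cong (reflexive (≡.cong (λ b → when b 1#) (≡.trans (eqᵇ-sym G′ G) G≢G′))) (∑-incidence-product n G G′ G≢G′) ⟩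
    0# + [ G ∶ G ∩ G′ ] * [ G′ ∶ G ∩ G′ ]
      ≈⟨ +-identityˡ _ ⟩
    [ G ∶ G ∩ G′ ] * [ G′ ∶ G ∩ G′ ]
      ≈⟨ -x*-y≈x*y _ _ ⟨
    - [ G ∶ G ∩ G′ ] * - [ G′ ∶ G ∩ G′ ]
      ≈⟨ *-cong (incidence-true-true G (G ∩ G′)) (incidence-true-true G′ (G ∩ G′)) ⟨
    [ true ∷ G ∶ true ∷ (G ∩ G′) ] * [ true ∷ G′ ∶ true ∷ (G ∩ G′) ] ∎
  ∑-incidence-product (suc n) (true ∷ G) (false ∷ G′) _ = begin
    _ ≈⟨ ∑-allSubsets-suc n _ ⟩
    _ + _
      ≈⟨ +-cong (trans (∑-cong (allSubsets n) (λ F → trans (incidence-when G F _)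
                          (reflexive (≡.cong (when (eqᵇ G F)) (incidence-false-false G′ F)))))
                       (∑-select′ n G _))
                (∑-zero (allSubsets n) (λ F → zeroʳ _)) ⟩
    [ G′ ∶ G ] + 0#
      ≈⟨ +-identityʳ _ ⟩
    [ G′ ∶ G ]
      ≈⟨ incidence-∩ G G′ ⟩
    when (eqᵇ G (G ∩ G′)) 1# * [ G′ ∶ G ∩ G′ ]
      ≡⟨ ≡.sym (≡.cong₂ _*_ (incidence-true-false G (G ∩ G′)) (incidence-false-false G′ (G ∩ G′))) ⟩
    [ true ∷ G ∶ false ∷ (G ∩ G′) ] * [ false ∷ G′ ∶ false ∷ (G ∩ G′) ] ∎
  ∑-incidence-product (suc n) (false ∷ G) (true ∷ G′) _ = begin
    _ ≈⟨ ∑-allSubsets-suc n _ ⟩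
    _ + _
      ≈⟨ +-cong (trans (∑-cong (allSubsets n) (λ F → trans (*-comm _ _) (trans (incidence-when G′ F _)
                          (reflexive (≡.cong (when (eqᵇ G′ F)) (incidence-false-false G F))))))
                       (∑-select′ n G′ _))
                (∑-zero (allSubsets n) (λ F → zeroˡ _)) ⟩
    [ G ∶ G′ ] + 0#
      ≈⟨ +-identityʳ _ ⟩
    [ G ∶ G′ ]
      ≈⟨ incidence-∩ G′ G ⟩
    when (eqᵇ G′ (G′ ∩ G)) 1# * [ G ∶ G′ ∩ G ]
      ≡⟨ ≡.cong (λ I → when (eqᵇ G′ I) 1# * [ G ∶ I ]) (∩-comm G′ G) ⟩
    when (eqᵇ G′ (G ∩ G′)) 1# * [ G ∶ G ∩ G′ ]
      ≈⟨ *-comm _ _ ⟩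
    [ G ∶ G ∩ G′ ] * when (eqᵇ G′ (G ∩ G′)) 1#
      ≡⟨ ≡.sym (≡.cong₂ _*_ (incidence-false-false G (G ∩ G′)) (incidence-true-false G′ (G ∩ G′))) ⟩
    [ false ∷ G ∶ false ∷ (G ∩ G′) ] * [ true ∷ G′ ∶ false ∷ (G ∩ G′) ] ∎

  module _ {n : ℕ} (X : SimplicialComplex n) where

    isFace : Subset n → Bool
    isFace F = memᵇ F (faces X)

    isFace-⊆ : ∀ {F G} → isFace G ≡ true → F ⊆ G → isFace F ≡ true
    isFace-⊆ {F} {G} G∈X F⊆G = memᵇ-complete F (faces X) (closed X (memᵇ-sound G (faces X) G∈X) F⊆G)

    adjacentᵇ : Subset n → Subset n → Bool
    adjacentᵇ G G′ = not (eqᵇ G G′) ∧ isFace (G ∪ G′)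

    adjacent⇒isFaceˡ : ∀ G G′ → adjacentᵇ G G′ ≡ true → isFace G ≡ true
    adjacent⇒isFaceˡ G G′ adj with eqᵇ G G′
    ... | false = isFace-⊆ adj (p⊆p∪q G′)

    adjacent⇒isFaceʳ : ∀ G G′ → adjacentᵇ G G′ ≡ true → isFace G′ ≡ true
    adjacent⇒isFaceʳ G G′ adj with eqᵇ G G′
    ... | false = isFace-⊆ adj (q⊆p∪q G G′)

    onFaces : ℕ → Subset n → Carrier → Carrier
    onFaces m F x = when (isFace F) (when (∣ F ∣ ≡ᵇ m) x)

    onFaces-cong : ∀ m F {x y} → x ≈ y → onFaces m F x ≈ onFaces m F y
    onFaces-cong m F x≈y = when-cong (isFace F) (when-cong (∣ F ∣ ≡ᵇ m) x≈y)

    onFaces-zero : ∀ m F {x} → x ≈ 0# → onFaces m F x ≈ 0#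
    onFaces-zero m F x≈0 = when-zero (isFace F) (when-zero (∣ F ∣ ≡ᵇ m) x≈0)

    onFaces-*ʳ : ∀ m F x y → onFaces m F (x * y) ≈ x * onFaces m F y
    onFaces-*ʳ m F x y = sym (trans (when-*ʳ (isFace F) x _) (when-cong (isFace F) (when-*ʳ (∣ F ∣ ≡ᵇ m) x y)))

    onFaces-∑ : ∀ {a} {A : Set a} m F xs (f : A → Carrier) → onFaces m F (∑ xs f) ≈ ∑ xs (λ x → onFaces m F (f x))
    onFaces-∑ m F xs f = sym (trans (∑-when xs (isFace F) _) (when-cong (isFace F) (∑-when xs (∣ F ∣ ≡ᵇ m) f)))

    onFaces-fromℕ : ∀ m F x → fromℕ 𝔽 ∣ F ∣ * onFaces m F x ≈ fromℕ 𝔽 m * onFaces m F x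
    onFaces-fromℕ m F x with isFace F
    ... | false = trans (zeroʳ _) (sym (zeroʳ _))
    ... | true with ∣ F ∣ ≡ᵇ m in e
    ...   | false = trans (zeroʳ _) (sym (zeroʳ _))
    ...   | true  = reflexive (≡.cong (λ i → fromℕ 𝔽 i * x) (≡ᵇ-sound ∣ F ∣ m e))

    sumSize-onFaces : ∀ m f → sumSize 𝔽 X m f ≈ ∑ (allSubsets n) (λ F → onFaces m F (f F))
    sumSize-onFaces m f = ∑-unique (faces X) (unique X) _

    -- [ G ∶ F ] ≠ 0 forces ∣ G ∣ = 1 + ∣ F ∣, and F ⊆ G ∈ X forces F ∈ X.
    onFaces-incidence : ∀ m G F x → onFaces m F ([ G ∶ F ] * when (isFace G) x) ≈ [ G ∶ F ] * onFaces (suc m) G x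
    onFaces-incidence m G F x with incidence-support G F
    ... | inj₁ [G∶F]≈0 = trans (onFaces-zero m F (trans (*-congʳ [G∶F]≈0) (zeroˡ _)))
                               (sym (trans (*-congʳ [G∶F]≈0) (zeroˡ _)))
    ... | inj₂ (F⊆G , 1+∣F∣≡∣G∣) with isFace G in G∈X
    ...   | false = trans (onFaces-zero m F (zeroʳ _)) (sym (zeroʳ _))
    ...   | true rewrite isFace-⊆ G∈X F⊆G | ≡.sym 1+∣F∣≡∣G∣ = sym (when-*ʳ (∣ F ∣ ≡ᵇ m) _ x)

    linkCochain : Cochain 𝔽 X → Subset n → Fin n → Carrier
    linkCochain z F v = [ F ∪ ⁅ v ⁆ ∶ F ] * z (F ∪ ⁅ v ⁆)

    sumLink-cong : ∀ F {f g : Fin n → Carrier} → (∀ v → lookup F v ≡ false → f v ≈ g v) →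
                   sumLink 𝔽 X F f ≈ sumLink 𝔽 X F g
    sumLink-cong F {f} {g} f≈g = ∑-cong (allFin n) onLink
      where
      onLink : ∀ v → when (not (lookup F v) ∧ isFace (F ∪ ⁅ v ⁆)) (f v) ≈ when (not (lookup F v) ∧ isFace (F ∪ ⁅ v ⁆)) (g v)
      onLink v with lookup F v in v∉F
      ... | true  = refl
      ... | false = when-cong (isFace (F ∪ ⁅ v ⁆)) (f≈g v v∉F)

    sumLink-cofaces : ∀ F (Φ : Subset n → Carrier) →
      sumLink 𝔽 X F (λ v → [ F ∪ ⁅ v ⁆ ∶ F ] * Φ (F ∪ ⁅ v ⁆)) ≈
      ∑ (allSubsets n) (λ H → [ H ∶ F ] * when (isFace H) (Φ H))
    sumLink-cofaces F Φ = begin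
      ∑ (allFin n) (λ v → when (not (lookup F v) ∧ isFace (F ∪ ⁅ v ⁆)) ([ F ∪ ⁅ v ⁆ ∶ F ] * Φ (F ∪ ⁅ v ⁆)))
        ≈⟨ ∑-cong (allFin n) (λ v → trans (reflexive (when-∧ (not (lookup F v)) _ _))
                                          (when-cong (not (lookup F v)) (sym (when-*ʳ (isFace (F ∪ ⁅ v ⁆)) _ _)))) ⟩
      ∑ (allFin n) (λ v → when (not (lookup F v)) ([ F ∪ ⁅ v ⁆ ∶ F ] * when (isFace (F ∪ ⁅ v ⁆)) (Φ (F ∪ ⁅ v ⁆))))
        ≈⟨ ∑-cofaces n F _ ⟨
      ∑ (allSubsets n) (λ H → [ H ∶ F ] * when (isFace H) (Φ H)) ∎

    innerLink-cofaces : ∀ z F → innerLink 𝔽 X F (linkCochain z F) ≈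
                        ∑ (allSubsets n) (λ H → [ H ∶ F ] * when (isFace H) ([ H ∶ F ] * (z H * z H)))
    innerLink-cofaces z F = trans (sumLink-cong F (λ v _ → square _ _)) (sumLink-cofaces F _)
      where
      square : ∀ a b → (a * b) * (a * b) ≈ a * (a * (b * b))
      square = ×-Solver.solve 2 (λ a b → (a ⊕ b) ⊕ (a ⊕ b) ⊜ a ⊕ (a ⊕ (b ⊕ b))) refl

    linkAdj-adjacent : ∀ F u v → lookup F u ≡ false → lookup F v ≡ false →
                       linkAdj 𝔽 X F u v ≡ when (adjacentᵇ (F ∪ ⁅ u ⁆) (F ∪ ⁅ v ⁆)) 1#
    linkAdj-adjacent F u v u∉F v∉F rewrite eqᵇ-∪⁅⁆ F u v u∉F v∉F | ∪-distribˡ-∪ F ⁅ u ⁆ ⁅ v ⁆ = ≡.refl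

    sumLink-adjacent : ∀ z F u → lookup F u ≡ false →
      sumLink 𝔽 X F (λ v → linkAdj 𝔽 X F u v * linkCochain z F v) ≈
      ∑ (allSubsets n) (λ G′ → [ G′ ∶ F ] * when (adjacentᵇ (F ∪ ⁅ u ⁆) G′) (z G′))
    sumLink-adjacent z F u u∉F = begin
      sumLink 𝔽 X F (λ v → linkAdj 𝔽 X F u v * linkCochain z F v)
        ≈⟨ sumLink-cong F (λ v v∉F → trans (*-congʳ (reflexive (linkAdj-adjacent F u v u∉F v∉F))) (selectAdjacent _ _ _)) ⟩
      sumLink 𝔽 X F (λ v → [ F ∪ ⁅ v ⁆ ∶ F ] * when (adjacentᵇ (F ∪ ⁅ u ⁆) (F ∪ ⁅ v ⁆)) (z (F ∪ ⁅ v ⁆)))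
        ≈⟨ sumLink-cofaces F _ ⟩
      ∑ (allSubsets n) (λ G′ → [ G′ ∶ F ] * when (isFace G′) (when (adjacentᵇ (F ∪ ⁅ u ⁆) G′) (z G′)))
        ≈⟨ ∑-cong (allSubsets n) (λ G′ → *-congˡ (when-absorb _ _ _ (adjacent⇒isFaceʳ (F ∪ ⁅ u ⁆) G′))) ⟩
      ∑ (allSubsets n) (λ G′ → [ G′ ∶ F ] * when (adjacentᵇ (F ∪ ⁅ u ⁆) G′) (z G′)) ∎
      where
      selectAdjacent : ∀ b x y → when b 1# * (x * y) ≈ x * when b y
      selectAdjacent b x y = trans (when-*ˡ b 1# _) (trans (when-cong b (*-identityˡ _)) (sym (when-*ʳ b x y)))

    quadLink-cofaces : ∀ z F → quadLink 𝔽 X F (linkCochain z F) ≈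
      ∑ (allSubsets n) (λ G → ∑ (allSubsets n) (λ G′ → [ G ∶ F ] * ([ G′ ∶ F ] * when (adjacentᵇ G G′) (z G′ * z G))))
    quadLink-cofaces z F = begin
      quadLink 𝔽 X F (linkCochain z F)
        ≈⟨ sumLink-cong F (λ u u∉F → trans (*-congʳ (sumLink-adjacent z F u u∉F)) (rotate _ _ _)) ⟩
      sumLink 𝔽 X F (λ u → [ F ∪ ⁅ u ⁆ ∶ F ] * (Y (F ∪ ⁅ u ⁆) * z (F ∪ ⁅ u ⁆)))
        ≈⟨ sumLink-cofaces F _ ⟩
      ∑ all (λ G → [ G ∶ F ] * when (isFace G) (Y G * z G))
        ≈⟨ ∑-cong all expand ⟩
      ∑ all (λ G → ∑ all (λ G′ → [ G ∶ F ] * ([ G′ ∶ F ] * when (adjacentᵇ G G′) (z G′ * z G)))) ∎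
      where
      all = allSubsets n
      Y : Subset n → Carrier
      Y G = ∑ all (λ G′ → [ G′ ∶ F ] * when (adjacentᵇ G G′) (z G′))
      rotate : ∀ y a b → y * (a * b) ≈ a * (y * b)
      rotate = ×-Solver.solve 3 (λ y a b → y ⊕ (a ⊕ b) ⊜ a ⊕ (y ⊕ b)) refl
      expand : ∀ G → [ G ∶ F ] * when (isFace G) (Y G * z G) ≈
                     ∑ all (λ G′ → [ G ∶ F ] * ([ G′ ∶ F ] * when (adjacentᵇ G G′) (z G′ * z G)))
      expand G = begin
        [ G ∶ F ] * when (isFace G) (Y G * z G)
          ≈⟨ *-congˡ (when-cong (isFace G) (sym (∑-*ʳ all (z G) _))) ⟩
        [ G ∶ F ] * when (isFace G) (∑ all (λ G′ → [ G′ ∶ F ] * when (adjacentᵇ G G′) (z G′) * z G))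
          ≈⟨ *-congˡ (sym (∑-when all (isFace G) _)) ⟩
        [ G ∶ F ] * ∑ all (λ G′ → when (isFace G) ([ G′ ∶ F ] * when (adjacentᵇ G G′) (z G′) * z G))
          ≈⟨ *-congˡ (∑-cong all (λ G′ → when-cong (isFace G)
               (trans (*-assoc _ _ _) (*-congˡ (when-*ˡ (adjacentᵇ G G′) _ _))))) ⟩
        [ G ∶ F ] * ∑ all (λ G′ → when (isFace G) ([ G′ ∶ F ] * when (adjacentᵇ G G′) (z G′ * z G)))
          ≈⟨ *-congˡ (∑-cong all (λ G′ → trans (sym (when-*ʳ (isFace G) _ _))
               (*-congˡ (when-absorb _ _ _ (adjacent⇒isFaceˡ G G′))))) ⟩
        [ G ∶ F ] * ∑ all (λ G′ → [ G′ ∶ F ] * when (adjacentᵇ G G′) (z G′ * z G))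
          ≈⟨ ∑-*ˡ all _ _ ⟨
        ∑ all (λ G′ → [ G ∶ F ] * ([ G′ ∶ F ] * when (adjacentᵇ G G′) (z G′ * z G))) ∎

    ∑-innerLink : ∀ m z → ∑ (allSubsets n) (λ F → onFaces m F (innerLink 𝔽 X F (linkCochain z F))) ≈
                          fromℕ 𝔽 (suc m) * inner 𝔽 X (suc m) z z
    ∑-innerLink m z = begin
      ∑ all (λ F → onFaces m F (innerLink 𝔽 X F (linkCochain z F)))
        ≈⟨ ∑-cong all (λ F → trans (onFaces-cong m F (innerLink-cofaces z F)) (onFaces-∑ m F all _)) ⟩
      ∑ all (λ F → ∑ all (λ H → onFaces m F ([ H ∶ F ] * when (isFace H) ([ H ∶ F ] * (z H * z H)))))
        ≈⟨ ∑-comm all all _ ⟩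
      ∑ all (λ H → ∑ all (λ F → onFaces m F ([ H ∶ F ] * when (isFace H) ([ H ∶ F ] * (z H * z H)))))
        ≈⟨ ∑-cong all (λ H → ∑-cong all (λ F → trans (onFaces-incidence m H F _)
             (trans (*-congˡ (onFaces-*ʳ (suc m) H _ _)) (sym (*-assoc _ _ _))))) ⟩
      ∑ all (λ H → ∑ all (λ F → [ H ∶ F ] * [ H ∶ F ] * onFaces (suc m) H (z H * z H)))
        ≈⟨ ∑-cong all (λ H → trans (∑-*ʳ all _ _) (trans (*-congʳ (∑-incidence² n H)) (onFaces-fromℕ (suc m) H _))) ⟩
      ∑ all (λ H → fromℕ 𝔽 (suc m) * onFaces (suc m) H (z H * z H))
        ≈⟨ ∑-*ˡ all _ _ ⟩
      fromℕ 𝔽 (suc m) * ∑ all (λ H → onFaces (suc m) H (z H * z H))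
        ≈⟨ *-congˡ (sumSize-onFaces (suc m) _) ⟨
      fromℕ 𝔽 (suc m) * inner 𝔽 X (suc m) z z ∎
      where all = allSubsets n

    -- A nonzero entry A_{k-1}(G, G′) forces G′ ∈ X to have k elements.
    onFaces-Aentry : ∀ k G G′ y → onFaces k G′ (Aentry 𝔽 X k G G′ * y) ≈ Aentry 𝔽 X k G G′ * y
    onFaces-Aentry k G G′ y with incidence-support G′ (G ∩ G′)
    ... | inj₁ [G′∶G∩G′]≈0 = trans (onFaces-zero k G′ Ay≈0) (sym Ay≈0)
      where
      Ay≈0 : Aentry 𝔽 X k G G′ * y ≈ 0#
      Ay≈0 = trans (*-congʳ (when-zero _ (trans (*-congˡ [G′∶G∩G′]≈0) (zeroʳ _)))) (zeroˡ y)
    ... | inj₂ (_ , 1+∣G∩G′∣≡∣G′∣)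
        with not (eqᵇ G G′) | suc ∣ G ∩ G′ ∣ ≡ᵇ k in size | isFace (G ∪ G′) in G∪G′∈X
    ...   | false | _     | _     = trans (onFaces-zero k G′ (zeroˡ y)) (sym (zeroˡ y))
    ...   | true  | false | _     = trans (onFaces-zero k G′ (zeroˡ y)) (sym (zeroˡ y))
    ...   | true  | true  | false = trans (onFaces-zero k G′ (zeroˡ y)) (sym (zeroˡ y))
    ...   | true  | true  | true
          rewrite isFace-⊆ G∪G′∈X (q⊆p∪q G G′) | ≡.sym 1+∣G∩G′∣≡∣G′∣ | size = refl

    -- For G ≠ G′, A_{k-1}(G, G′) = Σ_F [G : F] [G′ : F], as the only possible common facet is G ∩ G′.
    onFaces-Aentry-incidence : ∀ k G G′ y → onFaces k G (Aentry 𝔽 X k G G′ * y) ≈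
      ∑ (allSubsets n) (λ F → [ G ∶ F ] * [ G′ ∶ F ]) * onFaces k G (when (adjacentᵇ G G′) y)
    onFaces-Aentry-incidence k G G′ y with eqᵇ G G′ in G≡G′
    ... | true  = trans (onFaces-zero k G (zeroˡ y)) (sym (trans (*-congˡ (onFaces-zero k G refl)) (zeroʳ _)))
    ... | false with incidence-support G (G ∩ G′)
    ...   | inj₁ [G∶G∩G′]≈0 = trans (onFaces-zero k G (Ay≈0 _)) (sym (trans (*-congʳ s≈0) (zeroˡ _)))
      where
      p≈0 : [ G ∶ G ∩ G′ ] * [ G′ ∶ G ∩ G′ ] ≈ 0#
      p≈0 = trans (*-congʳ [G∶G∩G′]≈0) (zeroˡ _)
      Ay≈0 : ∀ b → when b ([ G ∶ G ∩ G′ ] * [ G′ ∶ G ∩ G′ ]) * y ≈ 0#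
      Ay≈0 b = trans (*-congʳ (when-zero b p≈0)) (zeroˡ y)
      s≈0 : ∑ (allSubsets n) (λ F → [ G ∶ F ] * [ G′ ∶ F ]) ≈ 0#
      s≈0 = trans (∑-incidence-product n G G′ G≡G′) p≈0
    ...   | inj₂ (_ , 1+∣G∩G′∣≡∣G∣) rewrite ≡.sym 1+∣G∩G′∣≡∣G∣ =
      trans (sizes (isFace G) (suc ∣ G ∩ G′ ∣ ≡ᵇ k) (isFace (G ∪ G′)))
            (*-congʳ (sym (∑-incidence-product n G G′ G≡G′)))
      where
      p = [ G ∶ G ∩ G′ ] * [ G′ ∶ G ∩ G′ ]
      sizes : ∀ a b c → when a (when b (when (b ∧ c) p * y)) ≈ p * when a (when b (when c y))
      sizes false b     c     = sym (zeroʳ p)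
      sizes true  false c     = sym (zeroʳ p)
      sizes true  true  c     = trans (when-*ˡ c p y) (sym (when-*ʳ c p y))

    ∑-quadLink : ∀ m z → ∑ (allSubsets n) (λ F → onFaces m F (quadLink 𝔽 X F (linkCochain z F))) ≈ quadA 𝔽 X (suc m) z
    ∑-quadLink m z = begin
      ∑ all (λ F → onFaces m F (quadLink 𝔽 X F (linkCochain z F)))
        ≈⟨ ∑-cong all (λ F → trans (onFaces-cong m F (quadLink-cofaces z F))
                                   (trans (onFaces-∑ m F all _) (∑-cong all (λ G → onFaces-∑ m F all _)))) ⟩
      ∑ all (λ F → ∑ all (λ G → ∑ all (λ G′ → onFaces m F ([ G ∶ F ] * ([ G′ ∶ F ] * w G G′)))))
        ≈⟨ trans (∑-comm all all _) (∑-cong all (λ G → ∑-comm all all _)) ⟩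
      ∑ all (λ G → ∑ all (λ G′ → ∑ all (λ F → onFaces m F ([ G ∶ F ] * ([ G′ ∶ F ] * w G G′)))))
        ≈⟨ ∑-cong all (λ G → ∑-cong all (λ G′ → trans (∑-cong all (λ F → localize G G′ F)) (∑-*ʳ all _ _))) ⟩
      ∑ all (λ G → ∑ all (λ G′ → ∑ all (λ F → [ G ∶ F ] * [ G′ ∶ F ]) * onFaces k G (w G G′)))
        ≈⟨ ∑-cong all (λ G → ∑-cong all (λ G′ → sym (entry G G′))) ⟩
      ∑ all (λ G → ∑ all (λ G′ → onFaces k G (onFaces k G′ (Aentry 𝔽 X k G G′ * z G′) * z G)))
        ≈⟨ ∑-cong all (λ G → trans (sym (onFaces-∑ k G all _)) (onFaces-cong k G (∑-*ʳ all _ _))) ⟩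
      ∑ all (λ G → onFaces k G (∑ all (λ G′ → onFaces k G′ (Aentry 𝔽 X k G G′ * z G′)) * z G))
        ≈⟨ ∑-cong all (λ G → onFaces-cong k G (*-congʳ (sumSize-onFaces k _))) ⟨
      ∑ all (λ G → onFaces k G (sumSize 𝔽 X k (λ G′ → Aentry 𝔽 X k G G′ * z G′) * z G))
        ≈⟨ sumSize-onFaces k _ ⟨
      quadA 𝔽 X k z ∎
      where
      all = allSubsets n
      k = suc m
      w : Subset n → Subset n → Carrier
      w G G′ = when (adjacentᵇ G G′) (z G′ * z G)
      localize : ∀ G G′ F → onFaces m F ([ G ∶ F ] * ([ G′ ∶ F ] * w G G′)) ≈
                            [ G ∶ F ] * [ G′ ∶ F ] * onFaces k G (w G G′)
      localize G G′ F = begin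
        onFaces m F ([ G ∶ F ] * ([ G′ ∶ F ] * w G G′))
          ≈⟨ onFaces-cong m F (*-congˡ (trans (*-congˡ (sym (when-absorb _ _ _ (adjacent⇒isFaceˡ G G′))))
                                                (when-*ʳ (isFace G) _ _))) ⟩
        onFaces m F ([ G ∶ F ] * when (isFace G) ([ G′ ∶ F ] * w G G′))
          ≈⟨ onFaces-incidence m G F _ ⟩
        [ G ∶ F ] * onFaces k G ([ G′ ∶ F ] * w G G′)
          ≈⟨ trans (*-congˡ (onFaces-*ʳ k G _ _)) (sym (*-assoc _ _ _)) ⟩
        [ G ∶ F ] * [ G′ ∶ F ] * onFaces k G (w G G′) ∎
      entry : ∀ G G′ → onFaces k G (onFaces k G′ (Aentry 𝔽 X k G G′ * z G′) * z G) ≈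
                       ∑ all (λ F → [ G ∶ F ] * [ G′ ∶ F ]) * onFaces k G (w G G′)
      entry G G′ = begin
        onFaces k G (onFaces k G′ (Aentry 𝔽 X k G G′ * z G′) * z G)
          ≈⟨ onFaces-cong k G (trans (*-congʳ (onFaces-Aentry k G G′ (z G′))) (*-assoc _ _ _)) ⟩
        onFaces k G (Aentry 𝔽 X k G G′ * (z G′ * z G))
          ≈⟨ onFaces-Aentry-incidence k G G′ _ ⟩
        ∑ all (λ F → [ G ∶ F ] * [ G′ ∶ F ]) * onFaces k G (w G G′) ∎

    indicator : Subset n → Cochain 𝔽 X
    indicator F G = when (eqᵇ G F) 1#

    δ-indicator : ∀ F H → isFace F ≡ true → δ 𝔽 X (∣ F ∣) (indicator F) H ≈ [ H ∶ F ]
    δ-indicator F H F∈X = begin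
      δ 𝔽 X (∣ F ∣) (indicator F) H
        ≈⟨ sumSize-onFaces (∣ F ∣) _ ⟩
      ∑ (allSubsets n) (λ G → onFaces (∣ F ∣) G ([ H ∶ G ] * indicator F G))
        ≈⟨ ∑-cong (allSubsets n) (λ G → trans (onFaces-cong (∣ F ∣) G (trans (when-*ʳ (eqᵇ G F) _ _)
             (when-cong (eqᵇ G F) (*-identityʳ _)))) (sym (swap (eqᵇ G F) (isFace G) (∣ G ∣ ≡ᵇ ∣ F ∣)))) ⟩
      ∑ (allSubsets n) (λ G → when (eqᵇ G F) (onFaces (∣ F ∣) G ([ H ∶ G ])))
        ≈⟨ ∑-select n F _ ⟩
      onFaces (∣ F ∣) F ([ H ∶ F ])
        ≡⟨ ≡.cong₂ (λ a b → when a (when b ([ H ∶ F ]))) F∈X (≡ᵇ-refl ∣ F ∣) ⟩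
      [ H ∶ F ] ∎
      where
      swap : ∀ a b c {x} → when a (when b (when c x)) ≈ when b (when c (when a x))
      swap false b     c     = sym (when-zero b (when-zero c refl))
      swap true  false c     = refl
      swap true  true  false = refl
      swap true  true  true  = refl

    innerOne-linkCochain : ∀ z F → isFace F ≡ true → PerpCoboundaries 𝔽 X (suc ∣ F ∣) z →
                           innerOne 𝔽 X F (linkCochain z F) ≈ 0#
    innerOne-linkCochain z F F∈X z⊥B = begin
      innerOne 𝔽 X F (linkCochain z F)
        ≈⟨ sumLink-cofaces F z ⟩
      ∑ (allSubsets n) (λ H → [ H ∶ F ] * when (isFace H) (z H))
        ≈⟨ ∑-cong (allSubsets n) (λ H → onFaces-incidence-face H) ⟩
      ∑ (allSubsets n) (λ H → onFaces (suc ∣ F ∣) H (δ 𝔽 X (∣ F ∣) (indicator F) H * z H))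
        ≈⟨ sumSize-onFaces (suc ∣ F ∣) _ ⟨
      inner 𝔽 X (suc ∣ F ∣) (δ 𝔽 X (∣ F ∣) (indicator F)) z
        ≈⟨ z⊥B (indicator F) ⟩
      0# ∎
      where
      onFaces-incidence-face : ∀ H → [ H ∶ F ] * when (isFace H) (z H) ≈
                                     onFaces (suc ∣ F ∣) H (δ 𝔽 X (∣ F ∣) (indicator F) H * z H)
      onFaces-incidence-face H = begin
        [ H ∶ F ] * when (isFace H) (z H)
          ≡⟨ ≡.cong₂ (λ a b → when a (when b ([ H ∶ F ] * when (isFace H) (z H)))) F∈X (≡ᵇ-refl ∣ F ∣) ⟨
        onFaces (∣ F ∣) F ([ H ∶ F ] * when (isFace H) (z H))
          ≈⟨ onFaces-incidence (∣ F ∣) H F (z H) ⟩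
        [ H ∶ F ] * onFaces (suc ∣ F ∣) H (z H)
          ≈⟨ onFaces-*ʳ (suc ∣ F ∣) H _ _ ⟨
        onFaces (suc ∣ F ∣) H ([ H ∶ F ] * z H)
          ≈⟨ onFaces-cong (suc ∣ F ∣) H (*-congʳ (δ-indicator F H F∈X)) ⟨
        onFaces (suc ∣ F ∣) H (δ 𝔽 X (∣ F ∣) (indicator F) H * z H) ∎

    quadA-zero : ∀ z → quadA 𝔽 X zero z ≈ 0#
    quadA-zero z = ∑-zero (faces X) (λ F → when-zero _ (trans (*-congʳ (∑-zero (faces X) (λ G → when-zero _
                     (trans (*-congʳ (noEntry (not (eqᵇ F G)))) (zeroˡ _))))) (zeroˡ _)))
      where
      noEntry : ∀ b {x} → when (b ∧ false) x ≈ 0#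
      noEntry true  = refl
      noEntry false = refl

  private module O = IsTotalOrder isTotalOrder

  AbsLe-resp : ∀ {x x′ y y′} → x ≈ x′ → y ≈ y′ → AbsLe 𝔽 x y → AbsLe 𝔽 x′ y′
  AbsLe-resp x≈x′ y≈y′ (-y≤x , x≤y) =
    O.trans (O.reflexive (-‿cong (sym y≈y′))) (O.trans -y≤x (O.reflexive x≈x′)) ,
    O.trans (O.reflexive (sym x≈x′)) (O.trans x≤y (O.reflexive y≈y′))

  AbsLe-zero : ∀ {x y} → x ≈ 0# → y ≈ 0# → AbsLe 𝔽 x y
  AbsLe-zero x≈0 y≈0 = AbsLe-resp (sym x≈0) (sym y≈0) (O.reflexive -0#≈0# , O.refl)

  +-mono-≤ : ∀ {a b c d} → a ≤ b → c ≤ d → (a + c) ≤ (b + d)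
  +-mono-≤ {a} {b} {c} {d} a≤b c≤d =
    O.trans (+-monoʳ-≤ c a≤b) (O.trans (O.reflexive (+-comm b c)) (O.trans (+-monoʳ-≤ b c≤d) (O.reflexive (+-comm d b))))

  AbsLe-+ : ∀ {a b c d} → AbsLe 𝔽 a b → AbsLe 𝔽 c d → AbsLe 𝔽 (a + c) (b + d)
  AbsLe-+ {b = b} {d = d} (-b≤a , a≤b) (-d≤c , c≤d) =
    O.trans (O.reflexive (sym (-‿+-comm b d))) (+-mono-≤ -b≤a -d≤c) , +-mono-≤ a≤b c≤d

  AbsLe-∑ : ∀ xs (f g : A → Carrier) → (∀ x → AbsLe 𝔽 (f x) (g x)) → AbsLe 𝔽 (∑ xs f) (∑ xs g)
  AbsLe-∑ []       f g f≤g = AbsLe-zero refl refl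
  AbsLe-∑ (x ∷ xs) f g f≤g = AbsLe-+ (f≤g x) (AbsLe-∑ xs f g f≤g)

  module _ {n : ℕ} (X : SimplicialComplex n) where

    LinkBound : Carrier → ℕ → Set (c ⊔ ℓ₁ ⊔ ℓ₂)
    LinkBound h k = ∀ F → F ∈ faces X → suc ∣ F ∣ ≡ k → ∀ w → innerOne 𝔽 X F w ≈ 0# →
                    AbsLe 𝔽 (quadLink 𝔽 X F w) (h * innerLink 𝔽 X F w)

    -- z ⊥ B^{k-1} makes each linkCochain z F orthogonal to 𝟏, so the link bound applies to it.
    onFaces-link-bound : ∀ h m → LinkBound h (suc m) → ∀ z → PerpCoboundaries 𝔽 X (suc m) z → ∀ F →
      AbsLe 𝔽 (onFaces X m F (quadLink 𝔽 X F (linkCochain X z F))) (h * onFaces X m F (innerLink 𝔽 X F (linkCochain X z F)))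
    onFaces-link-bound h m bound z z⊥B F with isFace X F in F∈X
    ... | false = AbsLe-zero refl (zeroʳ h)
    ... | true with ∣ F ∣ ≡ᵇ m in size
    ...   | false = AbsLe-zero refl (zeroʳ h)
    ...   | true with ≡ᵇ-sound ∣ F ∣ m size
    ...     | ≡.refl = bound F (memᵇ-sound F (faces X) F∈X) ≡.refl (linkCochain X z F)
                             (innerOne-linkCochain X z F F∈X z⊥B)

    quadA-bound : ∀ h m → LinkBound h (suc m) → ∀ z → PerpCoboundaries 𝔽 X (suc m) z →
                  AbsLe 𝔽 (quadA 𝔽 X (suc m) z) ((fromℕ 𝔽 (suc m) * h) * inner 𝔽 X (suc m) z z)
    quadA-bound h m bound z z⊥B =
      AbsLe-resp (∑-quadLink X m z) rhs (AbsLe-∑ (allSubsets n) _ _ (onFaces-link-bound h m bound z z⊥B))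
      where
      rhs : ∑ (allSubsets n) (λ F → h * onFaces X m F (innerLink 𝔽 X F (linkCochain X z F))) ≈
            (fromℕ 𝔽 (suc m) * h) * inner 𝔽 X (suc m) z z
      rhs = trans (∑-*ˡ (allSubsets n) h _) (trans (*-congˡ (∑-innerLink X m z))
              (×-Solver.solve 3 (λ a b c → a ⊕ (b ⊕ c) ⊜ (b ⊕ a) ⊕ c) refl _ _ _))

proposition3p5 : ∀ {c ℓ₁ ℓ₂ : Level} (𝔽 : OrderedField c ℓ₁ ℓ₂) (n k : ℕ)
    (X : SimplicialComplex n) → IsDimension X k →
    (h : OrderedField.Carrier 𝔽) → OrderedField._≤_ 𝔽 (OrderedField.0# 𝔽) h →
    (∀ F → F ∈ faces X → suc ∣ F ∣ ≡ k →
      ∀ (w : _) → OrderedField._≈_ 𝔽 (innerOne 𝔽 X F w) (OrderedField.0# 𝔽) →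
      AbsLe 𝔽 (quadLink 𝔽 X F w)
        (OrderedField._*_ 𝔽 h (innerLink 𝔽 X F w))) →
    ∀ (z : Cochain 𝔽 X) → PerpCoboundaries 𝔽 X k z →
    AbsLe 𝔽 (quadA 𝔽 X k z)
      (OrderedField._*_ 𝔽 (OrderedField._*_ 𝔽 (fromℕ 𝔽 k) h) (inner 𝔽 X k z z))
proposition3p5 𝔽 n zero    X _ h _ _     z _   =
  AbsLe-zero 𝔽 (quadA-zero 𝔽 X z) (trans (*-congʳ (zeroˡ h)) (zeroˡ _))
  where open OrderedField 𝔽
proposition3p5 𝔽 n (suc m) X _ h _ bound z z⊥B = quadA-bound 𝔽 X h m bound z z⊥B
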